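{- Let $n\ge1$ and let $\mathbb{P}=\mathrm{Trop}(y_1,\dots,y_{2n})$, with indices of the $y$'s read modulo $2n$. Define $M_{j,k}\in\mathbb{P}$ for integers $j$ and $k\ge -1$ with $j+k$ even by $M_{j,-1}=y_j^{ -1}$ ($j$ odd), $M_{j,0}=y_j$ ($j$ even), and for $k\ge1$ $$M_{j,k}=\frac{M_{j-3,k-1}M_{j+3,k-1}}{M_{j,k-2}}\cdot\frac{(1\oplus M_{j-1,k-1})(1\oplus M_{j+1,k-1})}{(1\oplus M_{j-3,k-1})(1\oplus M_{j+3,k-1})}.$$ Then $M_{j,k}=\prod_{i=-k}^{k}y_{j+3i}$ for all $j,k$ with $j+k$ even and $k\ge -1$.
   Context: The tropical semifield $\mathrm{Trop}(y_1,\dots,y_{2n})$ is the multiplicative group of Laurent monomials in $y_1,\dots,y_{2n}$ with the auxiliary addition $\prod_i y_i^{a_i}\oplus\prod_i y_i^{a'_i}=\prod_i y_i^{\min(a_i,a'_i)}$. Product convention: $\prod_{i=a}^{a-1}z_i=1$ and $\prod_{i=a}^{b}z_i=\prod_{i=b+1}^{a-1}z_i^{ -1}$ for $b<a-1$ (so $\prod_{i=1}^{ -1}y_{j+3i}=y_j^{ -1}$). -}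

module Defs where

open import Data.Nat as ℕ using (ℕ; zero; suc; NonZero)
open import Data.Integer using (ℤ; +_; -[1+_]; _+_; _-_; _*_; -_; _⊓_; _%ℕ_; 0ℤ; 1ℤ; ∣_∣)
open import Data.Fin using (Fin; toℕ)
open import Data.Bool using (if_then_else_)
open import Data.Nat using (_≡ᵇ_)

-- Elements of Trop(y_1,...,y_N) (N = 2n) are Laurent monomials, represented
-- by their exponent vectors (one integer exponent per variable y_t, t : Fin N;
-- the variable y_N is represented by index 0, since indices are read mod N).
Mon : ℕ → Set
Mon N = Fin N → ℤ

module _ {N : ℕ} where
  _·_ : Mon N → Mon N → Mon N
  (a · b) t = a t + b t
  _÷_ : Mon N → Mon N → Mon N
  (a ÷ b) t = a t - b t
  inv : Mon N → Mon N
  inv a t = - a t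
  _⊕_ : Mon N → Mon N → Mon N
  (a ⊕ b) t = a t ⊓ b t
  one : Mon N
  one t = 0ℤ

  infixl 7 _·_ _÷_
  infixl 6 _⊕_

twice-nonZero : (n : ℕ) → .{{_ : NonZero n}} → NonZero (2 ℕ.* n)
twice-nonZero (suc n) = _

y : (n : ℕ) .{{_ : NonZero n}} → ℤ → Mon (2 ℕ.* n)
y n j t = if toℕ t ≡ᵇ (_%ℕ_ j (2 ℕ.* n) {{twice-nonZero n}}) then 1ℤ else 0ℤ

prodLen : {N : ℕ} → ℤ → ℕ → (ℤ → Mon N) → Mon N
prodLen a zero    f = one
prodLen a (suc m) f = f a · prodLen (a + 1ℤ) m f

-- ∏_{i=a}^{b} f i with the paper's convention:
--   if b ≥ a-1 the ordinary product (empty product = 1 when b = a-1),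
--   if b < a-1 it is ∏_{i=b+1}^{a-1} (f i)^{-1}.
prodRange : {N : ℕ} → ℤ → ℤ → (ℤ → Mon N) → Mon N
prodRange a b f with b - a + 1ℤ
... | + m      = prodLen a m f
... | -[1+ m ] = inv (prodLen (b + 1ℤ) (suc m) f)

-- The family M_{j,k}, indexed here by r = k + 1 : ℕ (so k ≥ -1).
-- r = 0 : M_{j,-1} = y_j^{-1};  r = 1 : M_{j,0} = y_j;  r ≥ 2 : the recurrence.
-- (Values are defined for all j; the parity condition j+k even is imposed in
-- the statement, and the recurrence only refers to pairs of the same parity.)
Mr : (n : ℕ) .{{_ : NonZero n}} → ℤ → ℕ → Mon (2 ℕ.* n)
Mr n j zero = inv (y n j)
Mr n j (suc zero) = y n j
Mr n j (suc (suc r)) =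
  ((Mr n (j - + 3) (suc r) · Mr n (j + + 3) (suc r)) ÷ Mr n j r)
  · (((one ⊕ Mr n (j - 1ℤ) (suc r)) · (one ⊕ Mr n (j + 1ℤ) (suc r)))
     ÷ ((one ⊕ Mr n (j - + 3) (suc r)) · (one ⊕ Mr n (j + + 3) (suc r))))

-- M_{j,k} for integers j and k (meaningful for k ≥ -1)
M : (n : ℕ) .{{_ : NonZero n}} → ℤ → ℤ → Mon (2 ℕ.* n)
M n j k = Mr n j ∣ k + 1ℤ ∣

-- Work one exponent (one coordinate t) at a time. There the claimed closed form
-- is a sum of 2k+1 exponents y_{j+3i}(t) ∈ {0,1}, so for k ≥ 0 every M_{j,k} has
-- nonnegative exponent and every factor 1 ⊕ M_{·,k} equals 1. The recurrence thus
-- degenerates to M_{j,k+1} = M_{j-3,k} M_{j+3,k} / M_{j,k-1}, which sums over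
-- windows of an arithmetic progression satisfy: the windows of length 2k+1 centred
-- at j ∓ 3 overlap exactly in the window of length 2k-1 centred at j.
module Submission where

open import Defs
open import Data.Nat using (ℕ; NonZero; _*_)
open import Data.Integer using (ℤ; +_; _+_; -_; _≤_)
open import Data.Integer.Divisibility using (_∣_)
open import Data.Fin using (Fin)
open import Relation.Binary.PropositionalEquality using (_≡_)

import Data.Nat as ℕ
import Data.Nat.Properties as ℕ
import Data.Integer as ℤ
open import Data.Integer using (-[1+_]; _-_; _⊓_; 0ℤ; 1ℤ; ∣_∣; +≤+; -≤-)
open import Data.Integer.Properties
  using (+-mono-≤; +-identityʳ; i≤j⇒i⊓j≡i; neg-involutive)
open import Data.Integer.Tactic.RingSolver using (solve-∀)
open import Data.Bool using (true; false; if_then_else_)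
open import Relation.Binary.PropositionalEquality
  using (refl; cong; cong₂; sym; trans; subst; module ≡-Reasoning)

open ≡-Reasoning

apSum : (ℤ → ℤ) → ℤ → ℤ → ℕ → ℤ
apSum g d a ℕ.zero    = 0ℤ
apSum g d a (ℕ.suc m) = g a + apSum g d (a + d) m

apSum-nonneg : ∀ {g} → (∀ b → 0ℤ ≤ g b) → ∀ d a m → 0ℤ ≤ apSum g d a m
apSum-nonneg g≥0 d a ℕ.zero    = +≤+ ℕ.z≤n
apSum-nonneg g≥0 d a (ℕ.suc m) = +-mono-≤ (g≥0 a) (apSum-nonneg g≥0 d (a + d) m)

apSum-widen : ∀ g d a m →
  apSum g d a (2 ℕ.+ m) + apSum g d (a + d + d) (2 ℕ.+ m) - apSum g d (a + d + d) m
    ≡ apSum g d a (4 ℕ.+ m)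
apSum-widen g d a m =
  cancel (g a) (g (a + d)) (apSum g d (a + d + d) m) (apSum g d (a + d + d) (2 ℕ.+ m))
  where
  cancel : ∀ A B X Y → A + (B + X) + Y - X ≡ A + (B + Y)
  cancel = solve-∀

-- Indexed like Mr (r = k + 1): centredSum g d c (suc r) sums g over the 2r + 1
-- points c - r d, …, c + r d, and centredSum g d c 0 = - g c mirrors M_{c,-1}.

width : ℕ → ℕ
width ℕ.zero    = 1
width (ℕ.suc r) = 2 ℕ.+ width r

centredSum : (ℤ → ℤ) → ℤ → ℤ → ℕ → ℤ
centredSum g d c ℕ.zero    = - g c
centredSum g d c (ℕ.suc r) = apSum g d (c - d ℤ.* + r) (width r)

centredSum-recurrence : ∀ g d c r →
  centredSum g d (c - d) (ℕ.suc r) + centredSum g d (c + d) (ℕ.suc r) - centredSum g d c r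
    ≡ centredSum g d c (ℕ.suc (ℕ.suc r))
centredSum-recurrence g d c ℕ.zero = begin
  (g (c - d - d ℤ.* + 0) + 0ℤ) + (g (c + d - d ℤ.* + 0) + 0ℤ) - - g c
    ≡⟨ cong₂ (λ u v → (g u + 0ℤ) + (g v + 0ℤ) - - g c) (left c d) (right c d) ⟩
  (g a + 0ℤ) + (g (a + d + d) + 0ℤ) - - g c
    ≡⟨ reorder (g a) (g (a + d + d)) (g c) ⟩
  g a + (g c + (g (a + d + d) + 0ℤ))
    ≡⟨ cong (λ u → g a + (g u + (g (a + d + d) + 0ℤ))) (centre c d) ⟩
  apSum g d a 3
    ∎
  where
  a = c - d ℤ.* + 1
  left : ∀ c d → c - d - d ℤ.* + 0 ≡ c - d ℤ.* + 1
  left = solve-∀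
  right : ∀ c d → c + d - d ℤ.* + 0 ≡ c - d ℤ.* + 1 + d + d
  right = solve-∀
  centre : ∀ c d → c ≡ c - d ℤ.* + 1 + d
  centre = solve-∀
  reorder : ∀ A B C → (A + 0ℤ) + (B + 0ℤ) - - C ≡ A + (C + (B + 0ℤ))
  reorder = solve-∀
centredSum-recurrence g d c (ℕ.suc r) = begin
  apSum g d (c - d - d ℤ.* + ℕ.suc r) w + apSum g d (c + d - d ℤ.* + ℕ.suc r) w
    - apSum g d (c - d ℤ.* + r) (width r)
    ≡⟨ cong₃ (λ u v x → apSum g d u w + apSum g d v w - apSum g d x (width r))
             (left c d (+ r)) (right c d (+ r)) (middle c d (+ r)) ⟩
  apSum g d a w + apSum g d (a + d + d) w - apSum g d (a + d + d) (width r)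
    ≡⟨ apSum-widen g d a (width r) ⟩
  apSum g d a (width (ℕ.suc (ℕ.suc r)))
    ∎
  where
  w = width (ℕ.suc r)
  a = c - d ℤ.* + ℕ.suc (ℕ.suc r)
  cong₃ : ∀ {A : Set} (f : ℤ → ℤ → ℤ → A) {u u′ v v′ x x′} →
          u ≡ u′ → v ≡ v′ → x ≡ x′ → f u v x ≡ f u′ v′ x′
  cong₃ f refl refl refl = refl
  left : ∀ c d R → c - d - d ℤ.* (1ℤ + R) ≡ c - d ℤ.* (1ℤ + (1ℤ + R))
  left = solve-∀
  right : ∀ c d R → c + d - d ℤ.* (1ℤ + R) ≡ c - d ℤ.* (1ℤ + (1ℤ + R)) + d + d
  right = solve-∀
  middle : ∀ c d R → c - d ℤ.* R ≡ c - d ℤ.* (1ℤ + (1ℤ + R)) + d + d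
  middle = solve-∀

tropical-correction-vanishes : ∀ {p q u v} → 0ℤ ≤ p → 0ℤ ≤ q → 0ℤ ≤ u → 0ℤ ≤ v →
  (0ℤ ⊓ p + 0ℤ ⊓ q) - (0ℤ ⊓ u + 0ℤ ⊓ v) ≡ 0ℤ
tropical-correction-vanishes p≥0 q≥0 u≥0 v≥0
  rewrite i≤j⇒i⊓j≡i p≥0 | i≤j⇒i⊓j≡i q≥0 | i≤j⇒i⊓j≡i u≥0 | i≤j⇒i⊓j≡i v≥0 = refl

prodLen-affine-apply : ∀ {N} (F : ℤ → Mon N) (j d a : ℤ) m (t : Fin N) →
  prodLen a m (λ i → F (j + d ℤ.* i)) t ≡ apSum (λ b → F b t) d (j + d ℤ.* a) m
prodLen-affine-apply F j d a ℕ.zero    t = refl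
prodLen-affine-apply F j d a (ℕ.suc m) t =
  cong (_+_ (F (j + d ℤ.* a) t))
    (trans (prodLen-affine-apply F j d (a + 1ℤ) m t)
           (cong (λ b → apSum (λ b → F b t) d b m) (shift j d a)))
  where
  shift : ∀ j d a → j + d ℤ.* (a + 1ℤ) ≡ j + d ℤ.* a + d
  shift = solve-∀

prodRange-length : ∀ {N} a b (f : ℤ → Mon N) m →
  b - a + 1ℤ ≡ + m → prodRange a b f ≡ prodLen a m f
prodRange-length a b f m eq rewrite eq = refl

width-symmetric : ∀ m → + m - - + m + 1ℤ ≡ + width m
width-symmetric m = begin
  + m - - + m + 1ℤ  ≡⟨ cong (λ x → + m + x + 1ℤ) (neg-involutive (+ m)) ⟩
  + (m ℕ.+ m ℕ.+ 1) ≡⟨ cong +_ (double+1 m) ⟩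
  + width m         ∎
  where
  double+1 : ∀ m → m ℕ.+ m ℕ.+ 1 ≡ width m
  double+1 ℕ.zero    = refl
  double+1 (ℕ.suc m) =
    cong ℕ.suc (trans (cong (ℕ._+ 1) (ℕ.+-suc m m)) (cong ℕ.suc (double+1 m)))

module Coordinate (n : ℕ) .{{_ : NonZero n}} (t : Fin (2 * n)) where

  yₜ : ℤ → ℤ
  yₜ b = y n b t

  yₜ-nonneg : ∀ b → 0ℤ ≤ yₜ b
  yₜ-nonneg b = indicator-nonneg _
    where
    indicator-nonneg : ∀ c → 0ℤ ≤ (if c then 1ℤ else 0ℤ)
    indicator-nonneg true  = +≤+ ℕ.z≤n
    indicator-nonneg false = +≤+ ℕ.z≤n

  closed⇒nonneg : ∀ r j → Mr n j (ℕ.suc r) t ≡ centredSum yₜ (+ 3) j (ℕ.suc r) →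
    0ℤ ≤ Mr n j (ℕ.suc r) t
  closed⇒nonneg r j eq =
    subst (0ℤ ≤_) (sym eq) (apSum-nonneg yₜ-nonneg (+ 3) (j - + 3 ℤ.* + r) (width r))

  Mr-closed : ∀ r j → Mr n j r t ≡ centredSum yₜ (+ 3) j r
  Mr-closed ℕ.zero j = refl
  Mr-closed (ℕ.suc ℕ.zero) j =
    trans (sym (+-identityʳ (yₜ j))) (cong (λ b → yₜ b + 0ℤ) (sym (+-identityʳ j)))
  Mr-closed (ℕ.suc (ℕ.suc r)) j = begin
    Mr n j (ℕ.suc (ℕ.suc r)) t
      ≡⟨ cong (_+_ base) (tropical-correction-vanishes
            (closed⇒nonneg r (j - 1ℤ) (Mr-closed (ℕ.suc r) (j - 1ℤ)))
            (closed⇒nonneg r (j + 1ℤ) (Mr-closed (ℕ.suc r) (j + 1ℤ)))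
            (closed⇒nonneg r (j - + 3) (Mr-closed (ℕ.suc r) (j - + 3)))
            (closed⇒nonneg r (j + + 3) (Mr-closed (ℕ.suc r) (j + + 3)))) ⟩
    base + 0ℤ
      ≡⟨ +-identityʳ base ⟩
    Mr n (j - + 3) (ℕ.suc r) t + Mr n (j + + 3) (ℕ.suc r) t - Mr n j r t
      ≡⟨ cong₂ _-_ (cong₂ _+_ (Mr-closed (ℕ.suc r) (j - + 3)) (Mr-closed (ℕ.suc r) (j + + 3)))
                   (Mr-closed r j) ⟩
    centredSum yₜ (+ 3) (j - + 3) (ℕ.suc r) + centredSum yₜ (+ 3) (j + + 3) (ℕ.suc r)
      - centredSum yₜ (+ 3) j r
      ≡⟨ centredSum-recurrence yₜ (+ 3) j r ⟩
    centredSum yₜ (+ 3) j (ℕ.suc (ℕ.suc r))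
      ∎
    where
    base = Mr n (j - + 3) (ℕ.suc r) t + Mr n (j + + 3) (ℕ.suc r) t - Mr n j r t

  prodRange-closed : ∀ j k → - + 1 ≤ k →
    prodRange (- k) k (λ i → y n (j + + 3 ℤ.* i)) t ≡ centredSum yₜ (+ 3) j ∣ k + 1ℤ ∣
  prodRange-closed j (+ m) _ = begin
    prodRange (- + m) (+ m) f t
      ≡⟨ cong (λ p → p t) (prodRange-length (- + m) (+ m) f (width m) (width-symmetric m)) ⟩
    prodLen (- + m) (width m) f t
      ≡⟨ prodLen-affine-apply (y n) j (+ 3) (- + m) (width m) t ⟩
    apSum yₜ (+ 3) (j + + 3 ℤ.* - + m) (width m)
      ≡⟨ cong (λ a → apSum yₜ (+ 3) a (width m)) (reflect j (+ m)) ⟩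
    centredSum yₜ (+ 3) j (ℕ.suc m)
      ≡⟨ cong (centredSum yₜ (+ 3) j) (ℕ.+-comm 1 m) ⟩
    centredSum yₜ (+ 3) j (m ℕ.+ 1)
      ∎
    where
    f = λ i → y n (j + + 3 ℤ.* i)
    reflect : ∀ j m → j + + 3 ℤ.* - m ≡ j - + 3 ℤ.* m
    reflect = solve-∀
  prodRange-closed j -[1+ ℕ.zero ] _ =
    cong -_ (trans (+-identityʳ _) (cong yₜ (+-identityʳ j)))
  prodRange-closed j -[1+ ℕ.suc m ] (-≤- ())

proposition4p1 : (n : ℕ) → .{{_ : NonZero n}} →
    (j k : ℤ) → - (+ 1) ≤ k → (+ 2) ∣ (j + k) →
    (t : Fin (2 * n)) →
    M n j k t ≡ prodRange (- k) k (λ i → y n (j + (+ 3) Data.Integer.* i)) t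
proposition4p1 n j k k≥-1 _ t =
  trans (Mr-closed ∣ k + 1ℤ ∣ j) (sym (prodRange-closed j k k≥-1))
  where open Coordinate n t
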